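{- Let $\mu=(\mu_1,\dots,\mu_r)$ be a partition with $r$ parts and $\gamma=(\gamma_1,\dots,\gamma_r)$ a sequence of nonnegative integers. Then \[ \sum_\omega\varepsilon\cdot x^{\mathrm{wt}(\omega)}=\sum_{\omega\ \mathrm{stable}}\varepsilon\cdot x^{\mathrm{wt}(\omega)}, \] where the left sum is over all $\mu$-word arrays of length $N$ and content $\gamma$, and the right sum over all stable $\mu$-word arrays of length $N$ and content $\gamma$.
   Context: $\mathfrak S_N$ acts on $\mathbb C[x_1,\dots,x_N]$ by permuting variables; $\varepsilon=\sum_{w\in\mathfrak S_N}\mathrm{sign}(w)\,w$; $x^\beta=x_1^{\beta_1}\cdots x_N^{\beta_N}$. A $\mu$-word array of length $N$ is a sequence $\omega=(w_1\mid\cdots\mid w_N)$ of finite (possibly empty) words over $\{1,\dots,r\}$; its content is $(c_1,\dots,c_r)$ where $c_i$ is the total number of occurrences of the letter $i$ in $w_1,\dots,w_N$. For a word $w$, $\mu_w$ is the sum of $\mu_j$ over letters $j$ of $w$ (with multiplicity). $\mathrm{wt}(\omega)=(\mu_{w_1}+N-1,\dots,\mu_{w_N}+0)$. An unstable pair consists of positions $1\le i<j\le N$ and factorizations $w_i=u_iv_i$, $w_j=u_jv_j$ (prefixes $u$, suffixes $v$, possibly empty) with $\mu_{v_i}-i=\mu_{v_j}-j$; $\omega$ is stable if it has none. -}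

module Defs where

open import Data.Nat using (ℕ; zero; suc; _≥_; _∸_; _<_) renaming (_+_ to _+ℕ_)
open import Data.Integer using (ℤ; +_; -_; _+_; _-_; _*_; 1ℤ; 0ℤ)
open import Data.Fin using (Fin; toℕ) renaming (_<_ to _<ᶠ_)
import Data.Fin.Properties as FinP
open import Data.Vec using (Vec; []; _∷_; lookup; tabulate; toList)
import Data.Vec.Properties as VecP
open import Data.Nat.ListAction using (sum)
open import Data.List using (List; []; _∷_; _++_; map; concatMap; allFin; filter; length)
open import Data.Product using (Σ; ∃; _×_; _,_)
open import Data.Bool using (Bool; true; false; if_then_else_)
open import Relation.Nullary using (¬_; does)
open import Relation.Binary.PropositionalEquality using (_≡_)
import Data.Nat.Properties as NatP
import Relation.Unary
import Data.List.Relation.Unary.Unique.Propositional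
import Data.List.Relation.Unary.Unique.DecPropositional as UDec

unique? : ∀ {n} → Relation.Unary.Decidable (Data.List.Relation.Unary.Unique.Propositional.Unique {A = Fin n})
unique? {n} = UDec.unique? (FinP._≟_ {n})

-- Words over the alphabet {1,…,r}, encoded as Fin r (letter k+1 ↔ index k).
Word : ℕ → Set
Word r = List (Fin r)

-- μ-word arrays of length N: (w₁ | ⋯ | w_N), position i+1 ↔ index i : Fin N.
WordArray : ℕ → ℕ → Set
WordArray r N = Vec (Word r) N

IsPartition : ∀ {r} → Vec ℕ r → Set
IsPartition {r} μ = (∀ (i : Fin r) → lookup μ i ≥ 1)
                  × (∀ (i j : Fin r) → toℕ i < toℕ j → lookup μ i ≥ lookup μ j)

μword : ∀ {r} → Vec ℕ r → Word r → ℕ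
μword μ w = sum (map (lookup μ) w)

occ : ∀ {r} → Fin r → Word r → ℕ
occ a [] = 0
occ a (b ∷ w) = if does (a FinP.≟ b) then suc (occ a w) else occ a w

content : ∀ {r N} → WordArray r N → Vec ℕ r
content ω = tabulate (λ a → sum (map (occ a) (toList ω)))

wt : ∀ {r N} → Vec ℕ r → WordArray r N → Vec ℕ N
wt {N = N} μ ω = tabulate (λ i → μword μ (lookup ω i) +ℕ (N ∸ suc (toℕ i)))

-- Unstable pair: positions i < j (1-based: i+1 < j+1) and factorizations
-- w_i = u_i v_i, w_j = u_j v_j with μ_{v_i} − i = μ_{v_j} − j (in ℤ).
UnstablePair : ∀ {r N} → Vec ℕ r → WordArray r N → Set
UnstablePair {r} {N} μ ω =
  Σ (Fin N) λ i → Σ (Fin N) λ j → (i <ᶠ j) ×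
  (Σ (Word r) λ ui → Σ (Word r) λ vi → Σ (Word r) λ uj → Σ (Word r) λ vj →
     (lookup ω i ≡ ui ++ vi) × (lookup ω j ≡ uj ++ vj) ×
     ((+ μword μ vi) - (+ suc (toℕ i)) ≡ (+ μword μ vj) - (+ suc (toℕ j))))

Stable : ∀ {r N} → Vec ℕ r → WordArray r N → Set
Stable μ ω = ¬ UnstablePair μ ω

-- Polynomials in ℤ[x₁,…,x_N] ⊆ ℂ[x₁,…,x_N], represented by their
-- coefficient function on exponent vectors (only finite sums of
-- monomials occur below). Two polynomials are equal iff all
-- coefficients agree.

Poly : ℕ → Set
Poly N = Vec ℕ N → ℤ

_⊕_ : ∀ {N} → Poly N → Poly N → Poly N
(p ⊕ q) α = p α + q α

zeroP : ∀ {N} → Poly N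
zeroP α = 0ℤ

sumP : ∀ {A : Set} {N} → (A → Poly N) → List A → Poly N
sumP f [] = zeroP
sumP f (a ∷ as) = f a ⊕ sumP f as

monomial : ∀ {N} → Vec ℕ N → Poly N
monomial β α = if does (VecP.≡-dec NatP._≟_ α β) then 1ℤ else 0ℤ

-- The symmetric group 𝔖_N: maps Fin N → Fin N (as vectors of images)
-- that are injective (= bijective).
allVecs : (n k : ℕ) → List (Vec (Fin n) k)
allVecs n zero = [] ∷ []
allVecs n (suc k) = concatMap (λ a → map (a ∷_) (allVecs n k)) (allFin n)

perms : (N : ℕ) → List (Vec (Fin N) N)
perms N = filter (λ w → unique? (toList w)) (allVecs N N)

inversions : ∀ {N} → Vec (Fin N) N → ℕ
inversions {N} w =
  length (filter (λ p → FinP._<?_ (lookup w (Data.Product.proj₂ p)) (lookup w (Data.Product.proj₁ p)))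
    (filter (λ p → FinP._<?_ (Data.Product.proj₁ p) (Data.Product.proj₂ p))
      (concatMap (λ i → map (λ j → (i , j)) (allFin N)) (allFin N))))
  where import Data.Product

sign : ∀ {N} → Vec (Fin N) N → ℤ
sign w = signPow (inversions w)
  where
  signPow : ℕ → ℤ
  signPow zero = 1ℤ
  signPow (suc n) = - signPow n

-- action of w on a monomial: w · x^β = ∏ᵢ x_{w(i)}^{βᵢ} = x^α with α_{w(i)} = βᵢ.
-- Coefficient form: coefficient of x^α in w·x^β is [α ∘ w = β].
act : ∀ {N} → Vec (Fin N) N → Poly N → Poly N
act {N} w p α = p (tabulate (λ i → lookup α (lookup w i)))

ε· : ∀ {N} → Poly N → Poly N
ε· {N} p = sumP (λ w α → sign w * act w p α) (perms N)

module Submission where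

-- For an array ω, the level of a suffix v of the word at position k is μ_v + (N − 1 − k):
-- the paper's μ_v − i at the 1-based position i = k + 1, shifted by N into ℕ.  The entries
-- of wt ω are the levels of the whole words, and ω is unstable iff two positions i < j carry
-- suffixes of a common level c.  On unstable arrays, take the lexicographically least such
-- triple (c , i , j) and exchange the prefixes in front of the two suffixes.  This keeps the
-- content and transposes wt ω at i and j, so ε · x^wt changes sign.  Since every μ_a ≥ 1, a
-- suffix of level at most c of the new word u_j v_i is a suffix of v_i, so the unstable
-- triples of level at most c are the same before and after the exchange: the least triple is
-- unchanged and the map is an involution.  Hence the unstable arrays cancel in pairs.

open import Defs
open import Algebra.Definitions using (Involutive)
open import Data.Bool.Base using (true; false; if_then_else_)
open import Data.Empty using (⊥-elim)
open import Data.Fin.Base as Fin using (Fin; zero; suc; toℕ)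
import Data.Fin.Properties as FinP
open import Data.Integer.Base as ℤ using (ℤ; +_; 0ℤ; 1ℤ; -1ℤ; -_; _+_; _-_; _*_; _^_)
import Data.Integer.Properties as ℤP
open import Data.List.Base as List
  using (List; []; _∷_; _++_; [_]; map; foldr; filter; concatMap; allFin; length)
open import Data.List.Membership.Propositional using (_∈_)
import Data.List.Membership.Propositional.Properties as ∈P
open import Data.List.Membership.Propositional.Properties.WithK using (unique∧set⇒bag)
import Data.List.Properties as ListP
open import Data.List.Relation.Binary.BagAndSetEquality using (∼bag⇒↭)
open import Data.List.Relation.Binary.Permutation.Propositional
  using (_↭_; ↭-refl; ↭-sym; ↭-trans; ↭-prep; ↭-swap; ↭⇒↭ₛ; module PermutationReasoning)
import Data.List.Relation.Binary.Permutation.Propositional.Properties as ↭P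
import Data.List.Relation.Binary.Permutation.Setoid.Properties as ↭ₛP
open import Data.List.Relation.Unary.All as All using (All; []; _∷_)
import Data.List.Relation.Unary.All.Properties as AllP
open import Data.List.Relation.Unary.AllPairs using ([]; _∷_)
open import Data.List.Relation.Unary.Any using (here; there)
open import Data.List.Relation.Unary.Unique.Propositional using (Unique)
import Data.List.Relation.Unary.Unique.Propositional.Properties as UniqueP
open import Data.Nat.Base as ℕ using (ℕ; zero; suc; _∸_; _<_)
import Data.Nat.ListAction as ℕ
import Data.Nat.ListAction.Properties as ℕ
import Data.Nat.Properties as ℕP
open import Data.Nat.Solver using (module +-*-Solver)
open import Data.Product.Base using (∃; ∃₂; _×_; _,_; proj₁; proj₂)
open import Data.Product.Relation.Binary.Lex.NonStrict using (×-totalOrder)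
open import Data.Product.Relation.Binary.Pointwise.NonDependent using (≡×≡⇒≡)
open import Data.Sum.Base using (_⊎_; inj₁; inj₂; [_,_]′)
open import Data.Vec.Base as Vec using (Vec; []; _∷_; lookup; toList; _[_]≔_)
import Data.Vec.Properties as VecP
open import Function.Base using (_∘_; id)
open import Function.Bundles using (_⇔_; mk⇔; Equivalence)
open import Level using (_⊔_)
open import Relation.Binary.Bundles using (TotalOrder)
open import Relation.Binary.Definitions using (tri<; tri≈; tri>)
open import Relation.Binary.PropositionalEquality hiding ([_])
open import Relation.Nullary.Decidable using (Dec; yes; no; does; map′; _×-dec_; dec-true; dec-false)
open import Relation.Nullary.Negation using (¬_)
open import Relation.Unary using (Pred; Decidable; ∁)
open import Relation.Unary.Properties using (∁?)

sumℤ : List ℤ → ℤ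
sumℤ = foldr _+_ 0ℤ

sumℤ-↭ : {xs ys : List ℤ} → xs ↭ ys → sumℤ xs ≡ sumℤ ys
sumℤ-↭ p = ↭ₛP.foldr-commMonoid (setoid ℤ) ℤP.+-0-isCommutativeMonoid (↭⇒↭ₛ p)

sumℤ-map-neg : (zs : List ℤ) → sumℤ (map -_ zs) ≡ - sumℤ zs
sumℤ-map-neg []       = refl
sumℤ-map-neg (z ∷ zs) =
  trans (cong (λ s → - z + s) (sumℤ-map-neg zs)) (sym (ℤP.neg-distrib-+ z (sumℤ zs)))

self-negating⇒0 : ∀ {s : ℤ} → s ≡ - s → s ≡ 0ℤ
self-negating⇒0 {+ zero}     _  = refl
self-negating⇒0 {+ suc _}    ()
self-negating⇒0 {ℤ.-[1+ _ ]} ()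

module _ {A : Set} where

  sumP-at : ∀ {N} (f : A → Poly N) (xs : List A) (α : Vec ℕ N) →
            sumP f xs α ≡ sumℤ (map (λ x → f x α) xs)
  sumP-at f []       α = refl
  sumP-at f (x ∷ xs) α = cong (λ s → f x α + s) (sumP-at f xs α)

  unique-sameElements⇒↭ : {xs ys : List A} → Unique xs → Unique ys →
                          (∀ {x} → x ∈ xs ⇔ x ∈ ys) → xs ↭ ys
  unique-sameElements⇒↭ uxs uys same = ∼bag⇒↭ (unique∧set⇒bag uxs uys same)

  map-involution-↭ : (g : A → A) → Involutive _≡_ g → {xs : List A} → Unique xs →
                     (∀ {x} → x ∈ xs → g x ∈ xs) → map g xs ↭ xs
  map-involution-↭ g g-inv {xs} uxs closed =
    unique-sameElements⇒↭ (UniqueP.map⁺ g-injective uxs) uxs (mk⇔ to from)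
    where
    g-injective : ∀ {x y} → g x ≡ g y → x ≡ y
    g-injective {x} {y} e = trans (sym (g-inv x)) (trans (cong g e) (g-inv y))
    to : ∀ {x} → x ∈ map g xs → x ∈ xs
    to x∈ with y , y∈ , refl ← ∈P.∈-map⁻ g x∈ = closed y∈
    from : ∀ {x} → x ∈ xs → x ∈ map g xs
    from {x} x∈ = subst (_∈ map g xs) (g-inv x) (∈P.∈-map⁺ g (closed x∈))

  sumℤ-reindex : (f : A → ℤ) (g : A → A) → Involutive _≡_ g → {xs : List A} → Unique xs →
                 (∀ {x} → x ∈ xs → g x ∈ xs) → sumℤ (map (f ∘ g) xs) ≡ sumℤ (map f xs)
  sumℤ-reindex f g g-inv {xs} uxs closed = begin
    sumℤ (map (f ∘ g) xs)   ≡⟨ cong sumℤ (ListP.map-∘ xs) ⟩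
    sumℤ (map f (map g xs)) ≡⟨ sumℤ-↭ (↭P.map⁺ f (map-involution-↭ g g-inv uxs closed)) ⟩
    sumℤ (map f xs)         ∎
    where open ≡-Reasoning

  sumℤ-sign-reversing≡0 : (f : A → ℤ) (g : A → A) → Involutive _≡_ g → {xs : List A} → Unique xs →
                          (∀ {x} → x ∈ xs → g x ∈ xs × f (g x) ≡ - f x) → sumℤ (map f xs) ≡ 0ℤ
  sumℤ-sign-reversing≡0 f g g-inv {xs} uxs reversing = self-negating⇒0 (begin
    sumℤ (map f xs)          ≡⟨ sumℤ-reindex f g g-inv uxs (proj₁ ∘ reversing) ⟨
    sumℤ (map (f ∘ g) xs)    ≡⟨ cong sumℤ (ListP.map-cong-local (All.tabulate (proj₂ ∘ reversing))) ⟩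
    sumℤ (map (-_ ∘ f) xs)   ≡⟨ cong sumℤ (ListP.map-∘ xs) ⟩
    sumℤ (map -_ (map f xs)) ≡⟨ sumℤ-map-neg (map f xs) ⟩
    - sumℤ (map f xs)        ∎)
    where open ≡-Reasoning

  sumℤ-partition : ∀ {p} {P : Pred A p} (P? : Decidable P) (f : A → ℤ) (xs : List A) →
                   sumℤ (map f xs) ≡ sumℤ (map f (filter P? xs)) + sumℤ (map f (filter (∁? P?) xs))
  sumℤ-partition P? f []       = refl
  sumℤ-partition P? f (x ∷ xs) with P? x
  ... | yes _ = trans (cong (λ s → f x + s) (sumℤ-partition P? f xs)) (sym (ℤP.+-assoc (f x) _ _))
  ... | no  _ = trans (cong (λ s → f x + s) (sumℤ-partition P? f xs))
                      (x∙yz≈y∙xz (f x) (sumℤ (map f (filter P? xs))) (sumℤ (map f (filter (∁? P?) xs))))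
    where open import Algebra.Properties.CommutativeSemigroup ℤP.+-commutativeSemigroup using (x∙yz≈y∙xz)

  sumℤ-sign-reversing-involution :
    ∀ {p q} {P : Pred A p} {Q : Pred A q} (P? : Decidable P) (g : A → A) → Involutive _≡_ g →
    (f : A → ℤ) {xs ys : List A} →
    Unique xs → (∀ x → x ∈ xs ⇔ Q x) → Unique ys → (∀ x → x ∈ ys ⇔ (Q x × P x)) →
    (∀ {x} → Q x → ¬ P x → Q (g x) × ¬ P (g x) × f (g x) ≡ - f x) →
    sumℤ (map f xs) ≡ sumℤ (map f ys)
  sumℤ-sign-reversing-involution P? g g-inv f {xs} {ys} uxs xs⇔Q uys ys⇔Q×P reversing = begin
    sumℤ (map f xs)                                                 ≡⟨ sumℤ-partition P? f xs ⟩
    sumℤ (map f (filter P? xs)) + sumℤ (map f (filter (∁? P?) xs)) ≡⟨ cong₂ _+_ kept cancelled ⟩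
    sumℤ (map f ys) + 0ℤ                                            ≡⟨ ℤP.+-identityʳ _ ⟩
    sumℤ (map f ys)                                                 ∎
    where
    open ≡-Reasoning
    kept : sumℤ (map f (filter P? xs)) ≡ sumℤ (map f ys)
    kept = sumℤ-↭ (↭P.map⁺ f (unique-sameElements⇒↭ (UniqueP.filter⁺ P? uxs) uys (mk⇔ to from)))
      where
      to : ∀ {x} → x ∈ filter P? xs → x ∈ ys
      to {x} x∈ with x∈xs , px ← ∈P.∈-filter⁻ P? x∈ =
        Equivalence.from (ys⇔Q×P x) (Equivalence.to (xs⇔Q x) x∈xs , px)
      from : ∀ {x} → x ∈ ys → x ∈ filter P? xs
      from {x} x∈ with qx , px ← Equivalence.to (ys⇔Q×P x) x∈ =
        ∈P.∈-filter⁺ P? (Equivalence.from (xs⇔Q x) qx) px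
    cancelled : sumℤ (map f (filter (∁? P?) xs)) ≡ 0ℤ
    cancelled = sumℤ-sign-reversing≡0 f g g-inv (UniqueP.filter⁺ (∁? P?) uxs) reversed
      where
      reversed : ∀ {x} → x ∈ filter (∁? P?) xs → g x ∈ filter (∁? P?) xs × f (g x) ≡ - f x
      reversed {x} x∈
        with x∈xs , ¬px ← ∈P.∈-filter⁻ (∁? P?) x∈
        with qgx , ¬pgx , fgx ← reversing (Equivalence.to (xs⇔Q x) x∈xs) ¬px =
        ∈P.∈-filter⁺ (∁? P?) (Equivalence.from (xs⇔Q (g x)) qgx) ¬pgx , fgx

module _ {A : Set} where

  extract₂-↭ : ∀ xs (a : A) ms b ys → xs ++ a ∷ ms ++ b ∷ ys ↭ a ∷ b ∷ xs ++ ms ++ ys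
  extract₂-↭ xs a ms b ys = begin
    xs ++ a ∷ ms ++ b ∷ ys   ↭⟨ ↭P.shift a xs (ms ++ b ∷ ys) ⟩
    a ∷ xs ++ ms ++ b ∷ ys   ≡⟨ cong (a ∷_) (ListP.++-assoc xs ms (b ∷ ys)) ⟨
    a ∷ (xs ++ ms) ++ b ∷ ys ↭⟨ ↭-prep a (↭P.shift b (xs ++ ms) ys) ⟩
    a ∷ b ∷ (xs ++ ms) ++ ys ≡⟨ cong (λ l → a ∷ b ∷ l) (ListP.++-assoc xs ms ys) ⟩
    a ∷ b ∷ xs ++ ms ++ ys   ∎
    where open PermutationReasoning

  transpose-↭ : ∀ xs (a : A) ms b ys → xs ++ a ∷ ms ++ b ∷ ys ↭ xs ++ b ∷ ms ++ a ∷ ys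
  transpose-↭ xs a ms b ys =
    ↭-trans (extract₂-↭ xs a ms b ys) (↭-trans (↭-swap a b ↭-refl) (↭-sym (extract₂-↭ xs b ms a ys)))

  distinct-around : ∀ xs {a : A} ms {b} ys → Unique (xs ++ a ∷ ms ++ b ∷ ys) →
                    a ≢ b × All (a ≢_) ms × All (b ≢_) ms
  distinct-around xs {a} ms {b} ys u
    with (a≢b ∷ a≢rest) ∷ b≢rest ∷ _
           ← ↭ₛP.Unique-resp-↭ (setoid A) (↭⇒↭ₛ (extract₂-↭ xs a ms b ys)) u
    = a≢b , inMiddle a≢rest , inMiddle b≢rest
    where
    inMiddle : ∀ {p} {P : Pred A p} → All P (xs ++ ms ++ ys) → All P ms
    inMiddle = AllP.++⁻ˡ ms ∘ AllP.++⁻ʳ xs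

  sum-map-extract₂ : ∀ (f : A → ℕ) xs X ms Y ys →
    ℕ.sum (map f (xs ++ X ∷ ms ++ Y ∷ ys)) ≡ f X ℕ.+ (f Y ℕ.+ ℕ.sum (map f (xs ++ ms ++ ys)))
  sum-map-extract₂ f xs X ms Y ys = ℕ.sum-↭ (↭P.map⁺ f (extract₂-↭ xs X ms Y ys))

  ∈-concatMap⁺′ : ∀ {B : Set} {f : A → List B} {x xs y} → x ∈ xs → y ∈ f x → y ∈ concatMap f xs
  ∈-concatMap⁺′ {f = f} x∈ y∈ = ∈P.∈-concat⁺′ y∈ (∈P.∈-map⁺ f x∈)

  suffix-∈-tails : ∀ (u v : List A) → v ∈ List.tails (u ++ v)
  suffix-∈-tails []      v = here refl
  suffix-∈-tails (a ∷ u) v = there (suffix-∈-tails u v)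

module _ {a ℓ₁ ℓ₂} (O : TotalOrder a ℓ₁ ℓ₂) where

  private
    module O = TotalOrder O
    A : Set a
    A = O.Carrier

  record Least {p} (P : Pred A p) (x : A) : Set (a ⊔ p ⊔ ℓ₂) where
    constructor least
    field
      holds   : P x
      minimal : ∀ {y} → P y → x O.≤ y

  module _ {p} {P : Pred A p} (P? : Decidable P) where

    leastIn : (xs : List A) → (∃ λ x → P x × All (λ y → P y → x O.≤ y) xs) ⊎ All (∁ P) xs
    leastIn []       = inj₂ []
    leastIn (x ∷ xs) with P? x | leastIn xs
    ... | no ¬px | inj₂ none          = inj₂ (¬px ∷ none)
    ... | no ¬px | inj₁ (m , pm , m≤) = inj₁ (m , pm , (⊥-elim ∘ ¬px) ∷ m≤)
    ... | yes px | inj₂ none          =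
      inj₁ (x , px , (λ _ → O.refl) ∷ All.map (λ ¬py py → ⊥-elim (¬py py)) none)
    ... | yes px | inj₁ (m , pm , m≤) with O.total x m
    ...   | inj₁ x≤m = inj₁ (x , px , (λ _ → O.refl) ∷ All.map (λ m≤y py → O.trans x≤m (m≤y py)) m≤)
    ...   | inj₂ m≤x = inj₁ (m , pm , (λ _ → m≤x) ∷ m≤)

    least-or-none : (xs : List A) → (∀ {y} → P y → y ∈ xs) → ∃ (Least P) ⊎ (∀ y → ¬ P y)
    least-or-none xs complete with leastIn xs
    ... | inj₁ (m , pm , m≤) = inj₁ (m , least pm λ py → All.lookup m≤ (complete py) py)
    ... | inj₂ none          = inj₂ (λ y py → All.lookup none (complete py) py)

  least-unique : ∀ {p} {P : Pred A p} {x y} → Least P x → Least P y → x O.≈ y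
  least-unique (least px x≤) (least py y≤) = O.antisym (x≤ py) (y≤ px)

  least-transfer : ∀ {p q} {P : Pred A p} {Q : Pred A q} {x} → Least P x → Q x →
                   (∀ {y} → y O.≤ x → Q y → P y) → Least Q x
  least-transfer {x = x} (least _ x≤) qx below⇒P =
    least qx λ {y} qy → [ id , (λ y≤x → x≤ (below⇒P y≤x qy)) ]′ (O.total x y)

-- Signs of permutations

𝟙 : ∀ {p} {P : Set p} → Dec P → ℕ
𝟙 P? = if does P? then 1 else 0

-1^-unique : (f : ℕ → ℤ) → f 0 ≡ 1ℤ → (∀ n → f (suc n) ≡ - f n) → ∀ n → f n ≡ -1ℤ ^ n
-1^-unique f f0 fsuc zero    = f0
-1^-unique f f0 fsuc (suc n) =
  trans (fsuc n) (trans (cong -_ (-1^-unique f f0 fsuc n)) (sym (ℤP.-1*i≡-i (-1ℤ ^ n))))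

-- `sign` is defined through a function local to it, which cannot be named; the meta
-- below is solved to that function by unification.
mutual
  private
    localSignPower : ∀ {N} → Vec (Fin N) N → ℕ → ℤ
    localSignPower = _

  sign≡-1^inversions : ∀ {N} (w : Vec (Fin N) N) → sign w ≡ -1ℤ ^ inversions w
  sign≡-1^inversions w with inversions w
  ... | k = -1^-unique (localSignPower w) refl (λ _ → refl) k

-1^-flip : ∀ m n k → m ℕ.+ n ≡ 1 → -1ℤ ^ (m ℕ.+ k) ≡ - -1ℤ ^ (n ℕ.+ k)
-1^-flip 0 1 k refl = sym (trans (cong -_ (ℤP.-1*i≡-i (-1ℤ ^ k))) (ℤP.neg-involutive (-1ℤ ^ k)))
-1^-flip 1 0 k refl = ℤP.-1*i≡-i (-1ℤ ^ k)

module _ {A : Set} where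

  length-filter² : ∀ {p q} {P : Pred A p} {Q : Pred A q} (P? : Decidable P) (Q? : Decidable Q) xs →
                   length (filter P? (filter Q? xs)) ≡ ℕ.sum (map (λ x → 𝟙 (Q? x ×-dec P? x)) xs)
  length-filter² P? Q? []       = refl
  length-filter² P? Q? (x ∷ xs) with Q? x
  ... | no  _ = length-filter² P? Q? xs
  ... | yes _ with P? x
  ...   | no  _ = length-filter² P? Q? xs
  ...   | yes _ = cong suc (length-filter² P? Q? xs)

  sum-map-concatMap : ∀ {B : Set} (f : A → ℕ) (g : B → List A) xs →
                      ℕ.sum (map f (concatMap g xs)) ≡ ℕ.sum (map (λ x → ℕ.sum (map f (g x))) xs)
  sum-map-concatMap f g []       = refl
  sum-map-concatMap f g (x ∷ xs) = begin
    ℕ.sum (map f (g x ++ concatMap g xs))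
      ≡⟨ cong ℕ.sum (ListP.map-++ f (g x) _) ⟩
    ℕ.sum (map f (g x) ++ map f (concatMap g xs))
      ≡⟨ ℕ.sum-++ (map f (g x)) _ ⟩
    ℕ.sum (map f (g x)) ℕ.+ ℕ.sum (map f (concatMap g xs))
      ≡⟨ cong (ℕ.sum (map f (g x)) ℕ.+_) (sum-map-concatMap f g xs) ⟩
    ℕ.sum (map f (g x)) ℕ.+ ℕ.sum (map (λ x → ℕ.sum (map f (g x))) xs) ∎
    where open ≡-Reasoning

sumFin : ∀ {n} → (Fin n → ℕ) → ℕ
sumFin {n} f = ℕ.sum (map f (allFin n))

sumFin-cong : ∀ {n} {f g : Fin n → ℕ} → (∀ i → f i ≡ g i) → sumFin f ≡ sumFin g
sumFin-cong {n} f≗g = cong ℕ.sum (ListP.map-cong f≗g (allFin n))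

sumFin-suc : ∀ {n} (f : Fin (suc n) → ℕ) → sumFin f ≡ f zero ℕ.+ sumFin (f ∘ suc)
sumFin-suc f = cong (λ s → f zero ℕ.+ ℕ.sum s)
  (trans (ListP.map-tabulate suc f) (sym (ListP.map-tabulate id (f ∘ suc))))

module _ {M : ℕ} where

  below : Fin M → List (Fin M) → ℕ
  below x ys = ℕ.sum (map (λ y → 𝟙 (y FinP.<? x)) ys)

  inv : List (Fin M) → ℕ
  inv []       = 0
  inv (x ∷ xs) = below x xs ℕ.+ inv xs

  -- `inversions` generalised to vectors of any length; `inversions w` reduces to `inversionsOf w`.
  inversionsOf : ∀ {n} → Vec (Fin M) n → ℕ
  inversionsOf {n} v =
    length (filter (λ p → lookup v (proj₂ p) FinP.<? lookup v (proj₁ p))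
      (filter (λ p → proj₁ p FinP.<? proj₂ p)
        (concatMap (λ i → map (λ j → (i , j)) (allFin n)) (allFin n))))

  inverted : ∀ {n} → Vec (Fin M) n → Fin n → Fin n → ℕ
  inverted v i j = 𝟙 ((i FinP.<? j) ×-dec (lookup v j FinP.<? lookup v i))

  inversionsOf-sumFin : ∀ {n} (v : Vec (Fin M) n) →
                        inversionsOf v ≡ sumFin (λ i → sumFin (inverted v i))
  inversionsOf-sumFin {n} v = begin
    inversionsOf v
      ≡⟨ length-filter² _ _ pairs ⟩
    ℕ.sum (map inverted-pair pairs)
      ≡⟨ sum-map-concatMap inverted-pair row (allFin n) ⟩
    sumFin (λ i → ℕ.sum (map inverted-pair (row i)))
      ≡⟨ sumFin-cong (λ i → cong ℕ.sum (ListP.map-∘ {g = inverted-pair} {f = i ,_} (allFin n))) ⟨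
    sumFin (λ i → sumFin (inverted v i)) ∎
    where
    open ≡-Reasoning
    row : Fin n → List (Fin n × Fin n)
    row i = map (i ,_) (allFin n)
    pairs : List (Fin n × Fin n)
    pairs = concatMap row (allFin n)
    inverted-pair : Fin n × Fin n → ℕ
    inverted-pair (i , j) = inverted v i j

  sumFin-below : ∀ {n} (x : Fin M) (v : Vec (Fin M) n) →
                 sumFin (λ j → 𝟙 (lookup v j FinP.<? x)) ≡ below x (toList v)
  sumFin-below x []      = refl
  sumFin-below x (y ∷ v) = trans (sumFin-suc (λ j → 𝟙 (lookup (y ∷ v) j FinP.<? x)))
                                 (cong (𝟙 (y FinP.<? x) ℕ.+_) (sumFin-below x v))

  sumFin-inverted : ∀ {n} (v : Vec (Fin M) n) → sumFin (λ i → sumFin (inverted v i)) ≡ inv (toList v)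
  sumFin-inverted []      = refl
  sumFin-inverted (x ∷ v) = begin
    sumFin (λ i → sumFin (inverted (x ∷ v) i))
      ≡⟨ sumFin-suc (λ i → sumFin (inverted (x ∷ v) i)) ⟩
    sumFin (inverted (x ∷ v) zero) ℕ.+ sumFin (λ i → sumFin (inverted (x ∷ v) (suc i)))
      ≡⟨ cong₂ ℕ._+_ (sumFin-suc (inverted (x ∷ v) zero))
                     (sumFin-cong (λ i → sumFin-suc (inverted (x ∷ v) (suc i)))) ⟩
    sumFin (λ j → 𝟙 (lookup v j FinP.<? x)) ℕ.+ sumFin (λ i → sumFin (inverted v i))
      ≡⟨ cong₂ ℕ._+_ (sumFin-below x v) (sumFin-inverted v) ⟩
    below x (toList v) ℕ.+ inv (toList v) ∎
    where open ≡-Reasoning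

  sgn : List (Fin M) → ℤ
  sgn l = -1ℤ ^ inv l

  sgn-∷ : ∀ (x : Fin M) l → sgn (x ∷ l) ≡ -1ℤ ^ below x l * sgn l
  sgn-∷ x l = ℤP.^-distribˡ-+-* -1ℤ (below x l) (inv l)

  below-↭ : ∀ (x : Fin M) {ys zs} → ys ↭ zs → below x ys ≡ below x zs
  below-↭ x p = ℕ.sum-↭ (↭P.map⁺ (λ y → 𝟙 (y FinP.<? x)) p)

  exactly-one-less : ∀ {a b : Fin M} → a ≢ b → 𝟙 (b FinP.<? a) ℕ.+ 𝟙 (a FinP.<? b) ≡ 1
  exactly-one-less {a} {b} a≢b with FinP.<-cmp a b
  ... | tri< a<b _ b≮a rewrite dec-false (b FinP.<? a) b≮a | dec-true (a FinP.<? b) a<b = refl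
  ... | tri≈ _ a≡b _ = ⊥-elim (a≢b a≡b)
  ... | tri> a≮b _ b<a rewrite dec-true (b FinP.<? a) b<a | dec-false (a FinP.<? b) a≮b = refl

  sgn-swap-front : ∀ {a b} ys → a ≢ b → sgn (a ∷ b ∷ ys) ≡ - sgn (b ∷ a ∷ ys)
  sgn-swap-front {a} {b} ys a≢b = begin
    -1ℤ ^ ((b<a ℕ.+ Ba) ℕ.+ (Bb ℕ.+ I))   ≡⟨ cong (-1ℤ ^_) (ℕP.+-assoc b<a Ba (Bb ℕ.+ I)) ⟩
    -1ℤ ^ (b<a ℕ.+ (Ba ℕ.+ (Bb ℕ.+ I)))   ≡⟨ -1^-flip b<a a<b _ (exactly-one-less a≢b) ⟩
    - -1ℤ ^ (a<b ℕ.+ (Ba ℕ.+ (Bb ℕ.+ I))) ≡⟨ cong (λ n → - -1ℤ ^ (a<b ℕ.+ n)) (x∙yz≈y∙xz Ba Bb I) ⟩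
    - -1ℤ ^ (a<b ℕ.+ (Bb ℕ.+ (Ba ℕ.+ I))) ≡⟨ cong (λ n → - -1ℤ ^ n) (ℕP.+-assoc a<b Bb (Ba ℕ.+ I)) ⟨
    - -1ℤ ^ ((a<b ℕ.+ Bb) ℕ.+ (Ba ℕ.+ I)) ∎
    where
    open ≡-Reasoning
    open import Algebra.Properties.CommutativeSemigroup ℕP.+-commutativeSemigroup using (x∙yz≈y∙xz)
    b<a a<b Ba Bb I : ℕ
    b<a = 𝟙 (b FinP.<? a)
    a<b = 𝟙 (a FinP.<? b)
    Ba  = below a ys
    Bb  = below b ys
    I   = inv ys

  sgn-swap-adjacent : ∀ {a b} → a ≢ b → ∀ xs ys → sgn (xs ++ a ∷ b ∷ ys) ≡ - sgn (xs ++ b ∷ a ∷ ys)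
  sgn-swap-adjacent a≢b []       ys = sgn-swap-front ys a≢b
  sgn-swap-adjacent {a} {b} a≢b (x ∷ xs) ys = begin
    sgn (x ∷ L)                   ≡⟨ sgn-∷ x L ⟩
    -1ℤ ^ below x L * sgn L       ≡⟨ cong₂ (λ n s → -1ℤ ^ n * s) (below-↭ x L↭L′)
                                             (sgn-swap-adjacent a≢b xs ys) ⟩
    -1ℤ ^ below x L′ * - sgn L′   ≡⟨ ℤP.neg-distribʳ-* (-1ℤ ^ below x L′) (sgn L′) ⟨
    - (-1ℤ ^ below x L′ * sgn L′) ≡⟨ cong -_ (sgn-∷ x L′) ⟨
    - sgn (x ∷ L′)                ∎
    where
    open ≡-Reasoning
    L L′ : List (Fin M)
    L  = xs ++ a ∷ b ∷ ys
    L′ = xs ++ b ∷ a ∷ ys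
    L↭L′ : L ↭ L′
    L↭L′ = ↭P.++⁺ˡ xs (↭-swap a b ↭-refl)

  sgn-move : ∀ {a ms} → All (a ≢_) ms → ∀ xs ys →
             sgn (xs ++ a ∷ ms ++ ys) ≡ -1ℤ ^ length ms * sgn (xs ++ ms ++ a ∷ ys)
  sgn-move []                         xs ys = sym (ℤP.*-identityˡ _)
  sgn-move {a} {m ∷ ms} (a≢m ∷ a≢ms) xs ys = begin
    sgn (xs ++ a ∷ m ∷ ms ++ ys)                ≡⟨ sgn-swap-adjacent a≢m xs (ms ++ ys) ⟩
    - sgn (xs ++ m ∷ a ∷ ms ++ ys)              ≡⟨ cong (-_ ∘ sgn) (ListP.++-assoc xs [ m ] _) ⟨
    - sgn ((xs ++ [ m ]) ++ a ∷ ms ++ ys)       ≡⟨ cong -_ (sgn-move a≢ms (xs ++ [ m ]) ys) ⟩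
    - (± * sgn ((xs ++ [ m ]) ++ ms ++ a ∷ ys)) ≡⟨ cong (λ l → - (± * sgn l)) (ListP.++-assoc xs [ m ] _) ⟩
    - (± * sgn L)                               ≡⟨ ℤP.neg-distribˡ-* ± (sgn L) ⟩
    - ± * sgn L                                 ≡⟨ cong (_* sgn L) (ℤP.-1*i≡-i ±) ⟨
    -1ℤ ^ length (m ∷ ms) * sgn L               ∎
    where
    open ≡-Reasoning
    ± : ℤ
    ± = -1ℤ ^ length ms
    L : List (Fin M)
    L = xs ++ m ∷ ms ++ a ∷ ys

  sgn-transpose : ∀ xs {a} ms {b} ys → Unique (xs ++ a ∷ ms ++ b ∷ ys) →
                  sgn (xs ++ b ∷ ms ++ a ∷ ys) ≡ - sgn (xs ++ a ∷ ms ++ b ∷ ys)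
  sgn-transpose xs {a} ms {b} ys u with a≢b , a≢ms , b≢ms ← distinct-around xs ms ys u = begin
    sgn (xs ++ b ∷ ms ++ a ∷ ys)         ≡⟨ sgn-move b≢ms xs (a ∷ ys) ⟩
    ± * sgn (xs ++ ms ++ b ∷ a ∷ ys)     ≡⟨ cong (λ l → ± * sgn l) (ListP.++-assoc xs ms _) ⟨
    ± * sgn ((xs ++ ms) ++ b ∷ a ∷ ys)   ≡⟨ cong (± *_) (sgn-swap-adjacent (a≢b ∘ sym) (xs ++ ms) ys) ⟩
    ± * - sgn ((xs ++ ms) ++ a ∷ b ∷ ys) ≡⟨ cong (λ l → ± * - sgn l) (ListP.++-assoc xs ms _) ⟩
    ± * - sgn (xs ++ ms ++ a ∷ b ∷ ys)   ≡⟨ ℤP.neg-distribʳ-* ± _ ⟨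
    - (± * sgn (xs ++ ms ++ a ∷ b ∷ ys)) ≡⟨ cong -_ (sgn-move a≢ms xs (b ∷ ys)) ⟨
    - sgn (xs ++ a ∷ ms ++ b ∷ ys)       ∎
    where
    open ≡-Reasoning
    ± : ℤ
    ± = -1ℤ ^ length ms

sign≡sgn : ∀ {N} (w : Vec (Fin N) N) → sign w ≡ sgn (toList w)
sign≡sgn w = trans (sign≡-1^inversions w) (cong (-1ℤ ^_) (trans (inversionsOf-sumFin w) (sumFin-inverted w)))

module _ {A : Set} {n : ℕ} where

  lookup-ext : {u v : Vec A n} → (∀ k → lookup u k ≡ lookup v k) → u ≡ v
  lookup-ext {u} {v} u≗v =
    trans (sym (VecP.tabulate∘lookup u)) (trans (VecP.tabulate-cong u≗v) (VecP.tabulate∘lookup v))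

  lookup-ext₂ : ∀ {u v : Vec A n} i j → lookup u i ≡ lookup v i → lookup u j ≡ lookup v j →
                (∀ k → k ≢ i → k ≢ j → lookup u k ≡ lookup v k) → u ≡ v
  lookup-ext₂ {u} {v} i j at-i at-j elsewhere = lookup-ext at
    where
    at : ∀ k → lookup u k ≡ lookup v k
    at k with k FinP.≟ i | k FinP.≟ j
    ... | yes refl | _        = at-i
    ... | no _     | yes refl = at-j
    ... | no k≢i   | no k≢j   = elsewhere k k≢i k≢j

  module _ {i j : Fin n} (i≢j : i ≢ j) (v : Vec A n) (x y : A) where

    lookup-≔₂-first : lookup (v [ i ]≔ x [ j ]≔ y) i ≡ x
    lookup-≔₂-first = trans (VecP.lookup∘update′ i≢j (v [ i ]≔ x) y) (VecP.lookup∘update i v x)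

    lookup-≔₂-second : lookup (v [ i ]≔ x [ j ]≔ y) j ≡ y
    lookup-≔₂-second = VecP.lookup∘update j (v [ i ]≔ x) y

    lookup-≔₂-other : ∀ k → k ≢ i → k ≢ j → lookup (v [ i ]≔ x [ j ]≔ y) k ≡ lookup v k
    lookup-≔₂-other k k≢i k≢j =
      trans (VecP.lookup∘update′ k≢j (v [ i ]≔ x) y) (VecP.lookup∘update′ k≢i v x)

  ≔₂-lookup : ∀ (v : Vec A n) i j → v [ i ]≔ lookup v i [ j ]≔ lookup v j ≡ v
  ≔₂-lookup v i j = trans (cong (_[ j ]≔ lookup v j) (VecP.[]≔-lookup v i)) (VecP.[]≔-lookup v j)

  swapAt : Fin n → Fin n → Vec A n → Vec A n
  swapAt i j v = v [ i ]≔ lookup v j [ j ]≔ lookup v i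

  module _ {i j : Fin n} (i≢j : i ≢ j) where

    swapAt-involutive : Involutive _≡_ (swapAt i j)
    swapAt-involutive v = lookup-ext₂ i j
      (trans (lookup-≔₂-first i≢j (swapAt i j v) _ _) (lookup-≔₂-second i≢j v _ _))
      (trans (lookup-≔₂-second i≢j (swapAt i j v) _ _) (lookup-≔₂-first i≢j v _ _))
      (λ k k≢i k≢j → trans (lookup-≔₂-other i≢j (swapAt i j v) _ _ k k≢i k≢j)
                           (lookup-≔₂-other i≢j v _ _ k k≢i k≢j))

    swapAt-⇔ : ∀ {u v} → u ≡ swapAt i j v ⇔ swapAt i j u ≡ v
    swapAt-⇔ {u} {v} = mk⇔
      (λ u≡ → trans (cong (swapAt i j) u≡) (swapAt-involutive v))
      (λ ≡v → trans (sym (swapAt-involutive u)) (cong (swapAt i j) ≡v))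

toList-≔ : ∀ {A : Set} {n} (v : Vec A n) j → ∃₂ λ ms ys → ∀ y → toList (v [ j ]≔ y) ≡ ms ++ y ∷ ys
toList-≔ (a ∷ v) zero    = [] , toList v , λ _ → refl
toList-≔ (a ∷ v) (suc j) with ms , ys , split ← toList-≔ v j = a ∷ ms , ys , cong (a ∷_) ∘ split

toList-≔₂ : ∀ {A : Set} {n} (v : Vec A n) {i j} → i Fin.< j →
            ∃ λ xs → ∃₂ λ ms ys → ∀ x y → toList (v [ i ]≔ x [ j ]≔ y) ≡ xs ++ x ∷ ms ++ y ∷ ys
toList-≔₂ (a ∷ v) {zero}  {suc j} _ with ms , ys , split ← toList-≔ v j =
  [] , ms , ys , λ x y → cong (x ∷_) (split y)
toList-≔₂ (a ∷ v) {suc i} {suc j} i<j with xs , ms , ys , split ← toList-≔₂ v (ℕ.s<s⁻¹ i<j) =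
  a ∷ xs , ms , ys , λ x y → cong (a ∷_) (split x y)

-- The antisymmetriser on monomials

concatMap-map≡cartesianProductWith : ∀ {A B C : Set} (f : A → B → C) xs ys →
  concatMap (λ a → map (f a) ys) xs ≡ List.cartesianProductWith f xs ys
concatMap-map≡cartesianProductWith f []       ys = refl
concatMap-map≡cartesianProductWith f (x ∷ xs) ys =
  cong (map (f x) ys ++_) (concatMap-map≡cartesianProductWith f xs ys)

allVecs-complete : ∀ n k (v : Vec (Fin n) k) → v ∈ allVecs n k
allVecs-complete n zero    []      = here refl
allVecs-complete n (suc k) (a ∷ v) =
  subst (a ∷ v ∈_) (sym (concatMap-map≡cartesianProductWith _∷_ (allFin n) (allVecs n k)))
    (∈P.∈-cartesianProductWith⁺ _∷_ (∈P.∈-allFin a) (allVecs-complete n k v))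

allVecs-unique : ∀ n k → Unique (allVecs n k)
allVecs-unique n zero    = [] ∷ []
allVecs-unique n (suc k) =
  subst Unique (sym (concatMap-map≡cartesianProductWith _∷_ (allFin n) (allVecs n k)))
    (UniqueP.cartesianProductWith⁺ _∷_ VecP.∷-injective (UniqueP.allFin⁺ n) (allVecs-unique n k))

perms-unique : ∀ N → Unique (perms N)
perms-unique N = UniqueP.filter⁺ _ (allVecs-unique N N)

∈-perms⇔ : ∀ {N} {w : Vec (Fin N) N} → w ∈ perms N ⇔ Unique (toList w)
∈-perms⇔ {N} {w} = mk⇔
  (proj₂ ∘ ∈P.∈-filter⁻ (λ w → unique? (toList w)) {xs = allVecs N N})
  (∈P.∈-filter⁺ (λ w → unique? (toList w)) (allVecs-complete N N w))

_∘ᵥ_ : ∀ {A : Set} {N} → Vec A N → Vec (Fin N) N → Vec A N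
α ∘ᵥ w = Vec.tabulate (λ k → lookup α (lookup w k))

monomial-resp-⇔ : ∀ {N} {β γ β′ γ′ : Vec ℕ N} → γ ≡ β ⇔ γ′ ≡ β′ →
                  monomial β γ ≡ monomial β′ γ′
monomial-resp-⇔ {β = β} {γ} {β′} {γ′} γ≡β⇔
  with VecP.≡-dec ℕP._≟_ γ β | VecP.≡-dec ℕP._≟_ γ′ β′
... | yes _   | yes _     = refl
... | no  _   | no  _     = refl
... | yes γ≡β | no γ′≢β′  = ⊥-elim (γ′≢β′ (Equivalence.to γ≡β⇔ γ≡β))
... | no γ≢β  | yes γ′≡β′ = ⊥-elim (γ≢β (Equivalence.from γ≡β⇔ γ′≡β′))

module _ {N : ℕ} {i j : Fin N} (i<j : i Fin.< j) where

  private
    i≢j : i ≢ j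
    i≢j = FinP.<⇒≢ i<j

  ∘ᵥ-swapAt : ∀ {A : Set} (α : Vec A N) w → α ∘ᵥ swapAt i j w ≡ swapAt i j (α ∘ᵥ w)
  ∘ᵥ-swapAt α w = lookup-ext₂ i j
    (at-swapped i (lookup-≔₂-first i≢j w _ _) (lookup-≔₂-first i≢j (α ∘ᵥ w) _ _))
    (at-swapped j (lookup-≔₂-second i≢j w _ _) (lookup-≔₂-second i≢j (α ∘ᵥ w) _ _))
    (λ k k≢i k≢j → at-swapped k (lookup-≔₂-other i≢j w _ _ k k≢i k≢j)
                                (lookup-≔₂-other i≢j (α ∘ᵥ w) _ _ k k≢i k≢j))
    where
    at-swapped : ∀ k {l} → lookup (swapAt i j w) k ≡ lookup w l →
                 lookup (swapAt i j (α ∘ᵥ w)) k ≡ lookup (α ∘ᵥ w) l →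
                 lookup (α ∘ᵥ swapAt i j w) k ≡ lookup (swapAt i j (α ∘ᵥ w)) k
    at-swapped k {l} w-at α∘w-at = begin
      lookup (α ∘ᵥ swapAt i j w) k       ≡⟨ VecP.lookup∘tabulate _ k ⟩
      lookup α (lookup (swapAt i j w) k) ≡⟨ cong (lookup α) w-at ⟩
      lookup α (lookup w l)              ≡⟨ VecP.lookup∘tabulate _ l ⟨
      lookup (α ∘ᵥ w) l                  ≡⟨ α∘w-at ⟨
      lookup (swapAt i j (α ∘ᵥ w)) k     ∎
      where open ≡-Reasoning

  monomial-swapAt : ∀ (β γ : Vec ℕ N) → monomial (swapAt i j β) γ ≡ monomial β (swapAt i j γ)
  monomial-swapAt β γ = monomial-resp-⇔ (swapAt-⇔ i≢j {γ} {β})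

  toList-swapAt : ∀ (w : Vec (Fin N) N) → ∃ λ xs → ∃₂ λ ms ys →
                  toList w ≡ xs ++ lookup w i ∷ ms ++ lookup w j ∷ ys ×
                  toList (swapAt i j w) ≡ xs ++ lookup w j ∷ ms ++ lookup w i ∷ ys
  toList-swapAt w with xs , ms , ys , split ← toList-≔₂ w i<j =
    xs , ms , ys , trans (cong toList (sym (≔₂-lookup w i j))) (split _ _) , split _ _

  swapAt-∈-perms : ∀ {w} → w ∈ perms N → swapAt i j w ∈ perms N
  swapAt-∈-perms {w} w∈ with xs , ms , ys , toList-w , toList-w′ ← toList-swapAt w =
    Equivalence.from ∈-perms⇔ (subst Unique (sym toList-w′)
      (↭ₛP.Unique-resp-↭ (setoid (Fin N)) (↭⇒↭ₛ (transpose-↭ xs _ ms _ ys))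
        (subst Unique toList-w (Equivalence.to ∈-perms⇔ w∈))))

  sign-swapAt : ∀ {w} → w ∈ perms N → sign (swapAt i j w) ≡ - sign w
  sign-swapAt {w} w∈ with xs , ms , ys , toList-w , toList-w′ ← toList-swapAt w = begin
    sign (swapAt i j w)                              ≡⟨ sign≡sgn (swapAt i j w) ⟩
    sgn (toList (swapAt i j w))                      ≡⟨ cong sgn toList-w′ ⟩
    sgn (xs ++ lookup w j ∷ ms ++ lookup w i ∷ ys)   ≡⟨ sgn-transpose xs ms ys distinct ⟩
    - sgn (xs ++ lookup w i ∷ ms ++ lookup w j ∷ ys) ≡⟨ cong (-_ ∘ sgn) toList-w ⟨
    - sgn (toList w)                                 ≡⟨ cong -_ (sign≡sgn w) ⟨
    - sign w                                         ∎
    where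
    open ≡-Reasoning
    distinct : Unique (xs ++ lookup w i ∷ ms ++ lookup w j ∷ ys)
    distinct = subst Unique toList-w (Equivalence.to ∈-perms⇔ w∈)

  ε·-swapAt : ∀ (β α : Vec ℕ N) → ε· (monomial (swapAt i j β)) α ≡ - ε· (monomial β) α
  ε·-swapAt β α = begin
    ε· (monomial (swapAt i j β)) α
      ≡⟨ sumP-at _ (perms N) α ⟩
    sumℤ (map (λ w → sign w * monomial (swapAt i j β) (α ∘ᵥ w)) (perms N))
      ≡⟨ cong sumℤ (ListP.map-cong-local (All.tabulate term-swapped)) ⟩
    sumℤ (map (-_ ∘ term ∘ swapAt i j) (perms N))
      ≡⟨ cong sumℤ (ListP.map-∘ (perms N)) ⟩
    sumℤ (map -_ (map (term ∘ swapAt i j) (perms N)))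
      ≡⟨ sumℤ-map-neg (map (term ∘ swapAt i j) (perms N)) ⟩
    - sumℤ (map (term ∘ swapAt i j) (perms N))
      ≡⟨ cong -_ (sumℤ-reindex term (swapAt i j) (swapAt-involutive i≢j) (perms-unique N) swapAt-∈-perms) ⟩
    - sumℤ (map term (perms N))
      ≡⟨ cong -_ (sumP-at _ (perms N) α) ⟨
    - ε· (monomial β) α ∎
    where
    open ≡-Reasoning
    term : Vec (Fin N) N → ℤ
    term w = sign w * monomial β (α ∘ᵥ w)
    term-swapped : ∀ {w} → w ∈ perms N → sign w * monomial (swapAt i j β) (α ∘ᵥ w) ≡ - term (swapAt i j w)
    term-swapped {w} w∈ = begin
      sign w * monomial (swapAt i j β) (α ∘ᵥ w) ≡⟨ cong (sign w *_) (monomial-swapAt β (α ∘ᵥ w)) ⟩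
      sign w * monomial β (swapAt i j (α ∘ᵥ w)) ≡⟨ cong (λ γ → sign w * monomial β γ) (∘ᵥ-swapAt α w) ⟨
      sign w * m′                               ≡⟨ cong (_* m′) sign-w ⟩
      - sign (swapAt i j w) * m′                ≡⟨ ℤP.neg-distribˡ-* (sign (swapAt i j w)) m′ ⟨
      - term (swapAt i j w)                     ∎
      where
      m′ : ℤ
      m′ = monomial β (α ∘ᵥ swapAt i j w)
      sign-w : sign w ≡ - sign (swapAt i j w)
      sign-w = trans (sym (ℤP.neg-involutive (sign w))) (cong -_ (sym (sign-swapAt w∈)))

module _ {r : ℕ} (μ : Vec ℕ r) where

  μword-++ : ∀ u v → μword μ (u ++ v) ≡ μword μ u ℕ.+ μword μ v
  μword-++ u v = trans (cong ℕ.sum (ListP.map-++ (lookup μ) u v)) (ℕ.sum-++ (map (lookup μ) u) _)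

  module _ (μ-pos : ∀ a → lookup μ a ℕ.≥ 1) where

    μword-suffix-< : ∀ a u v → μword μ v < μword μ (a ∷ u ++ v)
    μword-suffix-< a u v = begin
      suc (μword μ v)                          ≤⟨ ℕP.+-monoˡ-≤ (μword μ v) (μ-pos a) ⟩
      lookup μ a ℕ.+ μword μ v                 ≤⟨ ℕP.+-monoʳ-≤ (lookup μ a) (ℕP.m≤n+m _ (μword μ u)) ⟩
      lookup μ a ℕ.+ (μword μ u ℕ.+ μword μ v) ≡⟨ cong (lookup μ a ℕ.+_) (μword-++ u v) ⟨
      μword μ (a ∷ u ++ v)                     ∎
      where open ℕP.≤-Reasoning

    ++-injective-by-μword : ∀ u v x y → u ++ v ≡ x ++ y → μword μ v ≡ μword μ y → u ≡ x × v ≡ y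
    ++-injective-by-μword []      v []      y v≡y  _   = refl , v≡y
    ++-injective-by-μword []      v (a ∷ x) y refl v≈y = ⊥-elim (ℕP.<⇒≢ (μword-suffix-< a x y) (sym v≈y))
    ++-injective-by-μword (a ∷ u) v []      y refl v≈y = ⊥-elim (ℕP.<⇒≢ (μword-suffix-< a u v) v≈y)
    ++-injective-by-μword (a ∷ u) v (b ∷ x) y e    v≈y
      with refl , e′   ← ListP.∷-injective e
      with refl , refl ← ++-injective-by-μword u v x y e′ v≈y = refl , refl

    lighter⇒suffix : ∀ u v x y → u ++ v ≡ x ++ y → μword μ v ℕ.≤ μword μ y → ∃ λ s → y ≡ s ++ v
    lighter⇒suffix []      v []      y v≡y  _   = [] , sym v≡y
    lighter⇒suffix []      v (a ∷ x) y refl v≤y = ⊥-elim (ℕP.<⇒≱ (μword-suffix-< a x y) v≤y)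
    lighter⇒suffix (a ∷ u) v []      y y≡   _   = a ∷ u , sym y≡
    lighter⇒suffix (a ∷ u) v (b ∷ x) y e    v≤y = lighter⇒suffix u v x y (ListP.∷-injectiveʳ e) v≤y

occ-++ : ∀ {r} (a : Fin r) x y → occ a (x ++ y) ≡ occ a x ℕ.+ occ a y
occ-++ a []      y = refl
occ-++ a (b ∷ x) y with does (a FinP.≟ b)
... | true  = cong suc (occ-++ a x y)
... | false = occ-++ a x y

-- The sign-reversing involution on unstable arrays

module Unstable {r : ℕ} (N : ℕ) (μ : Vec ℕ r) (μ-pos : ∀ a → lookup μ a ℕ.≥ 1) where

  level : Fin N → Word r → ℕ
  level k v = μword μ v ℕ.+ (N ∸ suc (toℕ k))

  level-++ : ∀ k u v → level k (u ++ v) ≡ μword μ u ℕ.+ level k v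
  level-++ k u v = trans (cong (ℕ._+ (N ∸ suc (toℕ k))) (μword-++ μ u v)) (ℕP.+-assoc (μword μ u) _ _)

  lookup-wt : ∀ ω k → lookup (wt μ ω) k ≡ level k (lookup ω k)
  lookup-wt ω k = VecP.lookup∘tabulate _ k

  +level : ∀ k v → + level k v ≡ (+ μword μ v - + suc (toℕ k)) + + N
  +level k v = begin
    + (m ℕ.+ (N ∸ s)) ≡⟨ ℤP.pos-+ m (N ∸ s) ⟩
    + m + + (N ∸ s)   ≡⟨ cong (λ z → + m + z) +[N∸s] ⟩
    + m + (+ N - + s) ≡⟨ x∙yz≈xz∙y (+ m) (+ N) (- + s) ⟩
    (+ m - + s) + + N ∎
    where
    open ≡-Reasoning
    open import Algebra.Properties.CommutativeSemigroup ℤP.+-commutativeSemigroup using (x∙yz≈xz∙y)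
    m s : ℕ
    m = μword μ v
    s = suc (toℕ k)
    +[N∸s] : + (N ∸ s) ≡ + N - + s
    +[N∸s] = trans (sym (ℤP.⊖-≥ (FinP.toℕ<n k))) (sym (ℤP.m-n≡m⊖n N s))

  level≡⇔ : ∀ i j vᵢ vⱼ →
            (+ μword μ vᵢ - + suc (toℕ i) ≡ + μword μ vⱼ - + suc (toℕ j)) ⇔ (level i vᵢ ≡ level j vⱼ)
  level≡⇔ i j vᵢ vⱼ = mk⇔
    (λ e → ℤP.+-injective (trans (+level i vᵢ) (trans (cong (_+ + N) e) (sym (+level j vⱼ)))))
    (λ e → ∙-cancelʳ (+ N) _ _ (trans (sym (+level i vᵢ)) (trans (cong +_ e) (+level j vⱼ))))
    where open import Algebra.Properties.AbelianGroup ℤP.+-0-abelianGroup using (∙-cancelʳ)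

  record Factorisation (k : Fin N) (c : ℕ) (w : Word r) : Set where
    constructor factorisation
    field
      prefix suffix : Word r
      splits        : prefix ++ suffix ≡ w
      level≡        : level k suffix ≡ c

  open Factorisation

  factorisation? : ∀ k c w → Dec (Factorisation k c w)
  factorisation? k c [] with level k [] ℕP.≟ c
  ... | yes l≡c = yes (factorisation [] [] refl l≡c)
  ... | no  l≢c = no λ { (factorisation [] [] refl l≡c) → l≢c l≡c }
  factorisation? k c (a ∷ w) with level k (a ∷ w) ℕP.≟ c | factorisation? k c w
  ... | yes l≡c | _                                 = yes (factorisation [] (a ∷ w) refl l≡c)
  ... | no  _   | yes (factorisation u v refl l≡c) = yes (factorisation (a ∷ u) v refl l≡c)
  ... | no  l≢c | no  ¬f                            = no λ
    { (factorisation []      _ refl l≡c) → l≢c l≡c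
    ; (factorisation (_ ∷ u) v refl l≡c) → ¬f (factorisation u v refl l≡c)
    }

  factorisation-≡ : ∀ {k c w} (f g : Factorisation k c w) → prefix f ≡ prefix g × suffix f ≡ suffix g
  factorisation-≡ {k} f g = ++-injective-by-μword μ μ-pos (prefix f) (suffix f) (prefix g) (suffix g)
    (trans (splits f) (sym (splits g)))
    (ℕP.+-cancelʳ-≡ (N ∸ suc (toℕ k)) _ _ (trans (level≡ f) (sym (level≡ g))))

  factorisation-in-suffix : ∀ {k c} x v → Factorisation k c (x ++ v) → c ℕ.≤ level k v →
                            ∀ x′ → Factorisation k c (x′ ++ v)
  factorisation-in-suffix {k} x v (factorisation u s us≡xv refl) s≤v x′
    with t , refl ← lighter⇒suffix μ μ-pos u s x v us≡xv (ℕP.+-cancelʳ-≤ (N ∸ suc (toℕ k)) _ _ s≤v) =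
    factorisation (x′ ++ t) s (ListP.++-assoc x′ t s) refl

  Triple : Set
  Triple = ℕ × Fin N × Fin N

  data UnstableAt (ω : WordArray r N) : Triple → Set where
    unstableAt : ∀ {c i j} → i Fin.< j → Factorisation i c (lookup ω i) → Factorisation j c (lookup ω j) →
                 UnstableAt ω (c , i , j)

  unstableAt? : ∀ ω → Decidable (UnstableAt ω)
  unstableAt? ω (c , i , j) =
    map′ (λ (i<j , fᵢ , fⱼ) → unstableAt i<j fᵢ fⱼ) (λ { (unstableAt i<j fᵢ fⱼ) → i<j , fᵢ , fⱼ })
      ((i FinP.<? j) ×-dec factorisation? i c (lookup ω i) ×-dec factorisation? j c (lookup ω j))

  unstableAt⇒unstablePair : ∀ {ω t} → UnstableAt ω t → UnstablePair μ ω
  unstableAt⇒unstablePair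
    (unstableAt {i = i} {j} i<j (factorisation uᵢ vᵢ eᵢ lᵢ) (factorisation uⱼ vⱼ eⱼ lⱼ)) =
    i , j , i<j , uᵢ , vᵢ , uⱼ , vⱼ , sym eᵢ , sym eⱼ ,
    Equivalence.from (level≡⇔ i j vᵢ vⱼ) (trans lᵢ (sym lⱼ))

  unstablePair⇒unstableAt : ∀ {ω} → UnstablePair μ ω → ∃ (UnstableAt ω)
  unstablePair⇒unstableAt (i , j , i<j , uᵢ , vᵢ , uⱼ , vⱼ , eᵢ , eⱼ , e) =
    (level i vᵢ , i , j) , unstableAt i<j (factorisation uᵢ vᵢ (sym eᵢ) refl)
      (factorisation uⱼ vⱼ (sym eⱼ) (sym (Equivalence.to (level≡⇔ i j vᵢ vⱼ) e)))

  candidates : WordArray r N → List Triple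
  candidates ω = concatMap (λ i → concatMap (λ j → map (λ v → level i v , i , j)
                   (List.tails (lookup ω i))) (allFin N)) (allFin N)

  ∈-candidates : ∀ {ω t} → UnstableAt ω t → t ∈ candidates ω
  ∈-candidates (unstableAt {i = i} {j} _ (factorisation u v uv≡ refl) _) =
    ∈-concatMap⁺′ (∈P.∈-allFin i) (∈-concatMap⁺′ (∈P.∈-allFin j)
      (∈P.∈-map⁺ (λ v → level i v , i , j) (subst (λ w → v ∈ List.tails w) uv≡ (suffix-∈-tails u v))))

  tripleOrder : TotalOrder _ _ _
  tripleOrder = ×-totalOrder ℕP.≤-decTotalOrder (×-totalOrder (FinP.≤-decTotalOrder N) (FinP.≤-totalOrder N))

  open TotalOrder tripleOrder using () renaming (_≤_ to _≼_; _≈_ to _≋_)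

  ≼⇒level≤ : ∀ {s t : Triple} → s ≼ t → proj₁ s ℕ.≤ proj₁ t
  ≼⇒level≤ (inj₁ (s≤t , _)) = s≤t
  ≼⇒level≤ (inj₂ (refl , _)) = ℕP.≤-refl

  ≋⇒≡ : ∀ {s t : Triple} → s ≋ t → s ≡ t
  ≋⇒≡ (e₁ , e₂) = ≡×≡⇒≡ (e₁ , ≡×≡⇒≡ e₂)

  LeastUnstable : WordArray r N → Triple → Set
  LeastUnstable ω = Least tripleOrder (UnstableAt ω)

  leastUnstable? : ∀ ω → ∃ (LeastUnstable ω) ⊎ (∀ t → ¬ UnstableAt ω t)
  leastUnstable? ω = least-or-none tripleOrder (unstableAt? ω) (candidates ω) ∈-candidates

  none⇒stable : ∀ {ω} → (∀ t → ¬ UnstableAt ω t) → Stable μ ω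
  none⇒stable none unstable = let t , u = unstablePair⇒unstableAt unstable in none t u

  stable? : Decidable (Stable μ)
  stable? ω with leastUnstable? ω
  ... | inj₁ (_ , least u _) = no λ stable → stable (unstableAt⇒unstablePair u)
  ... | inj₂ none            = yes (none⇒stable none)

  unstable⇒least : ∀ {ω} → ¬ Stable μ ω → ∃ (LeastUnstable ω)
  unstable⇒least {ω} ¬stable with leastUnstable? ω
  ... | inj₁ lu   = lu
  ... | inj₂ none = ⊥-elim (¬stable (none⇒stable none))

  exchange : ∀ ω {t} → UnstableAt ω t → WordArray r N
  exchange ω (unstableAt {i = i} {j} _ fᵢ fⱼ) =
    ω [ i ]≔ (prefix fⱼ ++ suffix fᵢ) [ j ]≔ (prefix fᵢ ++ suffix fⱼ)

  exchange-irrelevant : ∀ ω {t} (u u′ : UnstableAt ω t) → exchange ω u ≡ exchange ω u′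
  exchange-irrelevant ω (unstableAt {i = i} {j} _ fᵢ fⱼ) (unstableAt _ gᵢ gⱼ)
    with pᵢ , sᵢ ← factorisation-≡ fᵢ gᵢ | pⱼ , sⱼ ← factorisation-≡ fⱼ gⱼ =
    cong₂ (λ X Y → ω [ i ]≔ X [ j ]≔ Y) (cong₂ _++_ pⱼ sᵢ) (cong₂ _++_ pᵢ sⱼ)

  module Exchange (ω : WordArray r N) {c i j} (i<j : i Fin.< j)
                  (fᵢ : Factorisation i c (lookup ω i)) (fⱼ : Factorisation j c (lookup ω j)) where

    private
      uᵢ vᵢ uⱼ vⱼ : Word r
      uᵢ = prefix fᵢ
      vᵢ = suffix fᵢ
      uⱼ = prefix fⱼ
      vⱼ = suffix fⱼ
      i≢j : i ≢ j
      i≢j = FinP.<⇒≢ i<j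

    ω′ : WordArray r N
    ω′ = exchange ω (unstableAt i<j fᵢ fⱼ)

    ω′-i : lookup ω′ i ≡ uⱼ ++ vᵢ
    ω′-i = lookup-≔₂-first i≢j ω _ _

    ω′-j : lookup ω′ j ≡ uᵢ ++ vⱼ
    ω′-j = lookup-≔₂-second i≢j ω _ _

    ω′-other : ∀ k → k ≢ i → k ≢ j → lookup ω′ k ≡ lookup ω k
    ω′-other = lookup-≔₂-other i≢j ω _ _

    unstable′ : UnstableAt ω′ (c , i , j)
    unstable′ = unstableAt i<j (factorisation uⱼ vᵢ (sym ω′-i) (level≡ fᵢ))
                               (factorisation uᵢ vⱼ (sym ω′-j) (level≡ fⱼ))

    exchange-involutive : exchange ω′ unstable′ ≡ ω
    exchange-involutive = lookup-ext₂ i j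
      (trans (lookup-≔₂-first i≢j ω′ _ _) (splits fᵢ))
      (trans (lookup-≔₂-second i≢j ω′ _ _) (splits fⱼ))
      (λ k k≢i k≢j → trans (lookup-≔₂-other i≢j ω′ _ _ k k≢i k≢j) (ω′-other k k≢i k≢j))

    factorisation-reflected : ∀ k {c′} → c′ ℕ.≤ c → Factorisation k c′ (lookup ω′ k) →
                              Factorisation k c′ (lookup ω k)
    factorisation-reflected k c′≤c f with k FinP.≟ i | k FinP.≟ j
    ... | yes refl | _ = subst (Factorisation k _) (splits fᵢ)
      (factorisation-in-suffix uⱼ vᵢ (subst (Factorisation k _) ω′-i f)
        (subst (_ ℕ.≤_) (sym (level≡ fᵢ)) c′≤c) uᵢ)
    ... | no _ | yes refl = subst (Factorisation k _) (splits fⱼ)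
      (factorisation-in-suffix uᵢ vⱼ (subst (Factorisation k _) ω′-j f)
        (subst (_ ℕ.≤_) (sym (level≡ fⱼ)) c′≤c) uⱼ)
    ... | no k≢i | no k≢j = subst (Factorisation k _) (ω′-other k k≢i k≢j) f

    unstable-reflected : ∀ {t} → proj₁ t ℕ.≤ c → UnstableAt ω′ t → UnstableAt ω t
    unstable-reflected c′≤c (unstableAt {i = i′} {j′} i′<j′ f g) =
      unstableAt i′<j′ (factorisation-reflected i′ c′≤c f) (factorisation-reflected j′ c′≤c g)

    least-after-exchange : LeastUnstable ω (c , i , j) → LeastUnstable ω′ (c , i , j)
    least-after-exchange lu =
      least-transfer tripleOrder lu unstable′ (λ t≼ → unstable-reflected (≼⇒level≤ t≼))

    wt-exchange : wt μ ω′ ≡ swapAt i j (wt μ ω)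
    wt-exchange = lookup-ext₂ i j
      (begin
        lookup (wt μ ω′) i             ≡⟨ lookup-wt ω′ i ⟩
        level i (lookup ω′ i)          ≡⟨ cong (level i) ω′-i ⟩
        level i (uⱼ ++ vᵢ)             ≡⟨ same-level uⱼ fᵢ fⱼ ⟩
        level j (uⱼ ++ vⱼ)             ≡⟨ cong (level j) (splits fⱼ) ⟩
        level j (lookup ω j)           ≡⟨ lookup-wt ω j ⟨
        lookup (wt μ ω) j              ≡⟨ lookup-≔₂-first i≢j (wt μ ω) _ _ ⟨
        lookup (swapAt i j (wt μ ω)) i ∎)
      (begin
        lookup (wt μ ω′) j             ≡⟨ lookup-wt ω′ j ⟩
        level j (lookup ω′ j)          ≡⟨ cong (level j) ω′-j ⟩
        level j (uᵢ ++ vⱼ)             ≡⟨ same-level uᵢ fⱼ fᵢ ⟩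
        level i (uᵢ ++ vᵢ)             ≡⟨ cong (level i) (splits fᵢ) ⟩
        level i (lookup ω i)           ≡⟨ lookup-wt ω i ⟨
        lookup (wt μ ω) i              ≡⟨ lookup-≔₂-second i≢j (wt μ ω) _ _ ⟨
        lookup (swapAt i j (wt μ ω)) j ∎)
      (λ k k≢i k≢j → begin
        lookup (wt μ ω′) k             ≡⟨ lookup-wt ω′ k ⟩
        level k (lookup ω′ k)          ≡⟨ cong (level k) (ω′-other k k≢i k≢j) ⟩
        level k (lookup ω k)           ≡⟨ lookup-wt ω k ⟨
        lookup (wt μ ω) k              ≡⟨ lookup-≔₂-other i≢j (wt μ ω) _ _ k k≢i k≢j ⟨
        lookup (swapAt i j (wt μ ω)) k ∎)
      where
      open ≡-Reasoning
      same-level : ∀ {k l c′ w w′} x (f : Factorisation k c′ w) (g : Factorisation l c′ w′) →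
                   level k (x ++ suffix f) ≡ level l (x ++ suffix g)
      same-level {k} {l} x f g = begin
        level k (x ++ suffix f)           ≡⟨ level-++ k x (suffix f) ⟩
        μword μ x ℕ.+ level k (suffix f) ≡⟨ cong (μword μ x ℕ.+_) (trans (level≡ f) (sym (level≡ g))) ⟩
        μword μ x ℕ.+ level l (suffix g) ≡⟨ level-++ l x (suffix g) ⟨
        level l (x ++ suffix g)           ∎

    content-exchange : content ω′ ≡ content ω
    content-exchange with xs , ms , ys , split ← toList-≔₂ ω i<j = VecP.tabulate-cong λ a → begin
      ℕ.sum (map (occ a) (toList ω′))
        ≡⟨ cong (ℕ.sum ∘ map (occ a)) (split _ _) ⟩
      ℕ.sum (map (occ a) (xs ++ (uⱼ ++ vᵢ) ∷ ms ++ (uᵢ ++ vⱼ) ∷ ys))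
        ≡⟨ sum-map-extract₂ (occ a) xs _ ms _ ys ⟩
      occ a (uⱼ ++ vᵢ) ℕ.+ (occ a (uᵢ ++ vⱼ) ℕ.+ rest a)
        ≡⟨ exchanged-occ a ⟩
      occ a (uᵢ ++ vᵢ) ℕ.+ (occ a (uⱼ ++ vⱼ) ℕ.+ rest a)
        ≡⟨ sum-map-extract₂ (occ a) xs _ ms _ ys ⟨
      ℕ.sum (map (occ a) (xs ++ (uᵢ ++ vᵢ) ∷ ms ++ (uⱼ ++ vⱼ) ∷ ys))
        ≡⟨ cong (ℕ.sum ∘ map (occ a)) (trans (sym (split _ _)) (cong toList ω-restored)) ⟩
      ℕ.sum (map (occ a) (toList ω)) ∎
      where
      open ≡-Reasoning
      rest : Fin r → ℕ
      rest a = ℕ.sum (map (occ a) (xs ++ ms ++ ys))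
      ω-restored : ω [ i ]≔ (uᵢ ++ vᵢ) [ j ]≔ (uⱼ ++ vⱼ) ≡ ω
      ω-restored = trans (cong₂ (λ X Y → ω [ i ]≔ X [ j ]≔ Y) (splits fᵢ) (splits fⱼ)) (≔₂-lookup ω i j)
      exchanged-occ : ∀ a → occ a (uⱼ ++ vᵢ) ℕ.+ (occ a (uᵢ ++ vⱼ) ℕ.+ rest a)
                          ≡ occ a (uᵢ ++ vᵢ) ℕ.+ (occ a (uⱼ ++ vⱼ) ℕ.+ rest a)
      exchanged-occ a rewrite occ-++ a uⱼ vᵢ | occ-++ a uᵢ vⱼ | occ-++ a uᵢ vᵢ | occ-++ a uⱼ vⱼ =
        solve 5 (λ Uᵢ Vᵢ Uⱼ Vⱼ R →
                   (Uⱼ :+ Vᵢ) :+ ((Uᵢ :+ Vⱼ) :+ R) := (Uᵢ :+ Vᵢ) :+ ((Uⱼ :+ Vⱼ) :+ R))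
          refl (occ a uᵢ) (occ a vᵢ) (occ a uⱼ) (occ a vⱼ) (rest a)
        where open +-*-Solver

  φ : WordArray r N → WordArray r N
  φ ω with leastUnstable? ω
  ... | inj₁ (_ , least u _) = exchange ω u
  ... | inj₂ _               = ω

  φ-stable : ∀ {ω} → (∀ t → ¬ UnstableAt ω t) → φ ω ≡ ω
  φ-stable {ω} none with leastUnstable? ω
  ... | inj₁ (t , least u _) = ⊥-elim (none t u)
  ... | inj₂ _               = refl

  φ-least : ∀ {ω t} (lu : LeastUnstable ω t) → φ ω ≡ exchange ω (Least.holds lu)
  φ-least {ω} lu with leastUnstable? ω
  ... | inj₂ none = ⊥-elim (none _ (Least.holds lu))
  ... | inj₁ (_ , lu′) with refl ← ≋⇒≡ (least-unique tripleOrder lu′ lu) =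
    exchange-irrelevant ω (Least.holds lu′) (Least.holds lu)

  φ-involutive : Involutive _≡_ φ
  φ-involutive ω = [ on-unstable , on-stable ]′ (leastUnstable? ω)
    where
    on-unstable : ∃ (LeastUnstable ω) → φ (φ ω) ≡ ω
    on-unstable (_ , lu@(least (unstableAt i<j fᵢ fⱼ) _)) = begin
      φ (φ ω)               ≡⟨ cong φ (φ-least lu) ⟩
      φ ω′                  ≡⟨ φ-least (least-after-exchange lu) ⟩
      exchange ω′ unstable′ ≡⟨ exchange-involutive ⟩
      ω                     ∎
      where
      open ≡-Reasoning
      open Exchange ω i<j fᵢ fⱼ
    on-stable : (∀ t → ¬ UnstableAt ω t) → φ (φ ω) ≡ ω
    on-stable none = trans (cong φ (φ-stable none)) (φ-stable none)

  φ-sign-reversing : ∀ {ω} → ¬ Stable μ ω →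
    ¬ Stable μ (φ ω) × content (φ ω) ≡ content ω ×
    (∀ α → ε· (monomial (wt μ (φ ω))) α ≡ - ε· (monomial (wt μ ω)) α)
  φ-sign-reversing {ω} ¬stable with _ , lu@(least (unstableAt i<j fᵢ fⱼ) _) ← unstable⇒least {ω} ¬stable
    rewrite φ-least lu =
    (λ stable → stable (unstableAt⇒unstablePair unstable′)) ,
    content-exchange ,
    λ α → trans (cong (λ β → ε· (monomial β) α) wt-exchange) (ε·-swapAt i<j (wt μ ω) α)
    where open Exchange ω i<j fᵢ fⱼ

lemma5p7 : ∀ {r : ℕ} (N : ℕ) (μ : Vec ℕ r) → IsPartition μ → (γ : Vec ℕ r) →
           (allArrays stableArrays : List (WordArray r N)) →
           Unique allArrays → (∀ ω → (ω ∈ allArrays) ⇔ (content ω ≡ γ)) →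
           Unique stableArrays →
           (∀ ω → (ω ∈ stableArrays) ⇔ ((content ω ≡ γ) × Stable μ ω)) →
           ∀ (α : Vec ℕ N) →
           sumP (λ ω → ε· (monomial (wt μ ω))) allArrays α
             ≡ sumP (λ ω → ε· (monomial (wt μ ω))) stableArrays α
lemma5p7 N μ (μ-pos , _) γ allArrays stableArrays unique-all all⇔ unique-stable stable⇔ α = begin
  sumP F allArrays α        ≡⟨ sumP-at F allArrays α ⟩
  sumℤ (map f allArrays)    ≡⟨ sumℤ-sign-reversing-involution stable? φ φ-involutive f
                                 unique-all all⇔ unique-stable stable⇔ reversing ⟩
  sumℤ (map f stableArrays) ≡⟨ sumP-at F stableArrays α ⟨
  sumP F stableArrays α     ∎
  where
  open ≡-Reasoning
  open Unstable N μ μ-pos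
  F : WordArray _ N → Poly N
  F ω = ε· (monomial (wt μ ω))
  f : WordArray _ N → ℤ
  f ω = F ω α
  reversing : ∀ {ω} → content ω ≡ γ → ¬ Stable μ ω →
              content (φ ω) ≡ γ × ¬ Stable μ (φ ω) × f (φ ω) ≡ - f ω
  reversing content≡γ ¬stable with ¬stable′ , same-content , ε·-reversed ← φ-sign-reversing ¬stable =
    trans same-content content≡γ , ¬stable′ , ε·-reversed α
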